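{- Let $\mathrm{M}$ be a matroid. The monomials $$\{h_{F_1}^{a_1} \dotsb h_{F_\ell}^{a_\ell} : \emptyset = F_0 < F_1 < \dotsb < F_\ell,\ a_1 \le \operatorname{rk}(F_1),\ a_i < \operatorname{rk}(F_i) - \operatorname{rk}(F_{i-1}) \text{ for } i=2, \dotsc, \ell\}$$ (with $\ell \ge 0$ and all $a_i \ge 1$) span $A^{\bullet}(\mathrm{M})$ over $\mathbb{Z}$.
   Context: A matroid $\mathrm{M}$ is a finite nonempty atomic ranked lattice $\mathcal{L}_{\mathrm{M}}$ (every element is the join of the atoms below it; every maximal chain in $[\emptyset, F]$ has length $\operatorname{rk}(F)$) whose rank function $\operatorname{rk}$ is submodular: $\operatorname{rk}(F_1 \vee F_2) + \operatorname{rk}(F_1 \wedge F_2) \le \operatorname{rk}(F_1) + \operatorname{rk}(F_2)$. Elements are called flats; the minimal element is $\emptyset$, the maximal $E$. Let $\overline{\mathcal{L}}_{\mathrm{M}} = \mathcal{L}_{\mathrm{M}} \setminus \{\emptyset\}$. The augmented Chow ring is $$A^{\bullet}(\mathrm{M}) = \frac{\mathbb{Z}[h_F]_{F \in \overline{\mathcal{L}}_{\mathrm{M}}}}{((h_{F} - h_{G \vee F})(h_G - h_{G \vee F}) : F, G \in \overline{\mathcal{L}}_{\mathrm{M}}) + (h_a^2,\ h_ah_F - h_ah_{F \vee a} : F \in \overline{\mathcal{L}}_{\mathrm{M}},\ a \text{ an atom})},$$ graded with each $h_F$ in degree $1$. -}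

module Defs where

open import Data.Nat using (ℕ; zero; suc) renaming (_≤_ to _≤ℕ_; _<_ to _<ℕ_; _+_ to _+ℕ_; _∸_ to _∸ℕ_)
open import Data.Integer using (ℤ; +_; -[1+_])
open import Data.Fin using (Fin) renaming (_≟_ to _≟F_)
open import Data.List using (List; []; _∷_)
open import Data.Product using (Σ; _×_; _,_; proj₁)
open import Data.Unit using (⊤)
open import Relation.Binary.PropositionalEquality using (_≡_; _≢_)
open import Relation.Nullary using (¬_)
open import Relation.Nullary.Decidable using (False)

record LatticeData : Set₁ where
  field
    n     : ℕ
    _≤_   : Fin n → Fin n → Set
    ≤-refl    : ∀ x → x ≤ x
    ≤-antisym : ∀ {x y} → x ≤ y → y ≤ x → x ≡ y
    ≤-trans   : ∀ {x y z} → x ≤ y → y ≤ z → x ≤ z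
    _∨_   : Fin n → Fin n → Fin n
    ∨-ub₁ : ∀ x y → x ≤ (x ∨ y)
    ∨-ub₂ : ∀ x y → y ≤ (x ∨ y)
    ∨-lub : ∀ {x y z} → x ≤ z → y ≤ z → (x ∨ y) ≤ z
    _∧_   : Fin n → Fin n → Fin n
    ∧-lb₁ : ∀ x y → (x ∧ y) ≤ x
    ∧-lb₂ : ∀ x y → (x ∧ y) ≤ y
    ∧-glb : ∀ {x y z} → z ≤ x → z ≤ y → z ≤ (x ∧ y)
    bot   : Fin n
    bot-≤ : ∀ x → bot ≤ x
    rk    : Fin n → ℕ

module LatticeNotions (L : LatticeData) where
  open LatticeData L

  _<_ : Fin n → Fin n → Set
  x < y = x ≤ y × x ≢ y

  _⋖_ : Fin n → Fin n → Set
  x ⋖ y = x < y × (∀ z → ¬ (x < z × z < y))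

  IsAtom : Fin n → Set
  IsAtom a = bot ⋖ a

  data MaxChain : Fin n → Fin n → ℕ → Set where
    done : ∀ x → MaxChain x x zero
    step : ∀ {x y z k} → x ⋖ y → MaxChain y z k → MaxChain x z (suc k)

  -- F is the join (least upper bound) of the atoms below it
  -- (F is trivially an upper bound of them; the content is leastness)
  IsJoinOfAtomsBelow : Fin n → Set
  IsJoinOfAtomsBelow F =
    ∀ G → (∀ a → IsAtom a → a ≤ F → a ≤ G) → F ≤ G

record Matroid : Set₁ where
  field
    lat : LatticeData
  open LatticeData lat public
  open LatticeNotions lat public
  field
    atomic     : ∀ F → IsJoinOfAtomsBelow F
    ranked     : ∀ F k → MaxChain bot F k → k ≡ rk F
    submodular : ∀ F G → rk (F ∨ G) +ℕ rk (F ∧ G) ≤ℕ rk F +ℕ rk G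

-- The augmented Chow ring, presented as the free commutative ring
-- (= ℤ[h_F]) on the nonempty flats, modulo the congruence generated by
-- the ring axioms and the defining relations (i.e. modulo the ideal).

module Chow (M : Matroid) where
  open Matroid M

  NonEmpty : Fin n → Set
  NonEmpty F = False (F ≟F bot)

  Flat̄ : Set
  Flat̄ = Σ (Fin n) NonEmpty

  infixl 6 _+p_
  infixl 7 _*p_

  data Poly : Set where
    h    : Flat̄ → Poly
    0p   : Poly
    1p   : Poly
    _+p_ : Poly → Poly → Poly
    _*p_ : Poly → Poly → Poly
    -p_  : Poly → Poly

  _-p_ : Poly → Poly → Poly
  x -p y = x +p (-p y)

  infix 4 _≈_
  data _≈_ : Poly → Poly → Set where
    ≈-refl  : ∀ {x} → x ≈ x
    ≈-sym   : ∀ {x y} → x ≈ y → y ≈ x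
    ≈-trans : ∀ {x y z} → x ≈ y → y ≈ z → x ≈ z
    +-cong  : ∀ {x x' y y'} → x ≈ x' → y ≈ y' → x +p y ≈ x' +p y'
    *-cong  : ∀ {x x' y y'} → x ≈ x' → y ≈ y' → x *p y ≈ x' *p y'
    neg-cong : ∀ {x x'} → x ≈ x' → -p x ≈ -p x'
    +-assoc : ∀ x y z → (x +p y) +p z ≈ x +p (y +p z)
    +-comm  : ∀ x y → x +p y ≈ y +p x
    +-idˡ   : ∀ x → 0p +p x ≈ x
    -‿invˡ  : ∀ x → (-p x) +p x ≈ 0p
    *-assoc : ∀ x y z → (x *p y) *p z ≈ x *p (y *p z)
    *-comm  : ∀ x y → x *p y ≈ y *p x
    *-idˡ   : ∀ x → 1p *p x ≈ x
    distribˡ : ∀ x y z → x *p (y +p z) ≈ (x *p y) +p (x *p z)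
    rel-join : ∀ (F G : Flat̄) (p : NonEmpty (proj₁ G ∨ proj₁ F)) →
      (h F -p h (proj₁ G ∨ proj₁ F , p)) *p (h G -p h (proj₁ G ∨ proj₁ F , p)) ≈ 0p
    rel-atom² : ∀ (a : Flat̄) → IsAtom (proj₁ a) → h a *p h a ≈ 0p
    rel-atom : ∀ (a F : Flat̄) → IsAtom (proj₁ a) → (p : NonEmpty (proj₁ F ∨ proj₁ a)) →
      (h a *p h F) -p (h a *p h (proj₁ F ∨ proj₁ a , p)) ≈ 0p

  _^p_ : Poly → ℕ → Poly
  x ^p zero = 1p
  x ^p suc k = x *p (x ^p k)

  fromℕ : ℕ → Poly
  fromℕ zero = 0p
  fromℕ (suc k) = 1p +p fromℕ k

  fromℤ : ℤ → Poly
  fromℤ (+ k) = fromℕ k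
  fromℤ -[1+ k ] = -p fromℕ (suc k)

  MonoData : Set
  MonoData = List (Flat̄ × ℕ)

  monomial : MonoData → Poly
  monomial [] = 1p
  monomial ((F , a) ∷ rest) = (h F ^p a) *p monomial rest

  AdmissibleTail : Fin n → MonoData → Set
  AdmissibleTail prev [] = ⊤
  AdmissibleTail prev ((F , a) ∷ rest) =
    prev < proj₁ F × 1 ≤ℕ a × a <ℕ (rk (proj₁ F) ∸ℕ rk prev) × AdmissibleTail (proj₁ F) rest

  Admissible : MonoData → Set
  Admissible [] = ⊤
  Admissible ((F , a) ∷ rest) =
    bot < proj₁ F × 1 ≤ℕ a × a ≤ℕ rk (proj₁ F) × AdmissibleTail (proj₁ F) rest

  AdmMono : Set
  AdmMono = Σ MonoData Admissible

  linComb : List (ℤ × AdmMono) → Poly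
  linComb [] = 0p
  linComb ((c , (m , _)) ∷ rest) = (fromℤ c *p monomial m) +p linComb rest

  AdmissibleMonomialsSpan : Set
  AdmissibleMonomialsSpan = ∀ (x : Poly) → Σ (List (ℤ × AdmMono)) (λ cs → x ≈ linComb cs)

-- Every product of generators is straightened into admissible monomials by well-founded
-- induction on the total corank of its factors. If two factors h_F, h_G have incomparable
-- flats, the relation (h_F − h_J)(h_G − h_J) = 0 with J = F ∨ G rewrites h_F h_G as
-- h_J h_F + h_J h_G − h_J², and J has smaller corank than F and G. Otherwise the factors
-- form a chain ∅ < F₁ < … < F_ℓ. The relations give h_F² = h_x h_F whenever x ⋖ F
-- (with h_∅ = 0), hence h_x h_F^a = h_F^(a+1) for a ≥ rk F − rk x along a maximal chain.
-- So the monomial vanishes if a₁ > rk F₁, and if a_i ≥ rk F_i − rk F_(i−1) one factor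
-- h_F_(i−1) is absorbed into h_F_i, which again lowers the corank.
module Submission where

open import Level using (_⊔_; 0ℓ)
open import Algebra.Bundles using (Ring; CommutativeRing)
open import Data.Bool.Properties using (T-irrelevant)
open import Data.Empty using (⊥-elim)
open import Data.Fin using (Fin; _≟_)
open import Data.Fin.Induction using (po-wellFounded; po-noetherian)
open import Data.Fin.Properties using (any?; all?)
open import Data.Integer using (ℤ; +_; -[1+_]) renaming (-_ to -ℤ_)
open import Data.List using (List; []; _∷_; _++_; map; foldr; replicate; allFin)
open import Data.List.Extrema.Nat using (max; xs≤max)
open import Data.List.Membership.Propositional.Properties using (∈-map⁺; ∈-allFin)
open import Data.List.Properties using (map-++)
open import Data.List.Relation.Binary.Permutation.Propositional
  using (_↭_; ↭-refl; ↭-sym; ↭-trans; ↭-reflexive; prep; swap; ↭⇒↭ₛ′)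
open import Data.List.Relation.Binary.Permutation.Propositional.Properties
  using (++⁺ˡ; shift; shifts)
import Data.List.Relation.Binary.Permutation.Propositional.Properties as ↭
import Data.List.Relation.Binary.Permutation.Setoid.Properties as PermutationSetoidProperties
import Data.List.Relation.Unary.All as All
open import Data.Nat using (ℕ; zero; suc; z<s; z≤n; s≤s)
  renaming ( _≤_ to _≤ℕ_; _<_ to _<ℕ_; _+_ to _+ℕ_; _∸_ to _∸ℕ_
           ; _≤?_ to _≤ℕ?_; _<?_ to _<ℕ?_)
open import Data.Nat.Induction using () renaming (<-wellFounded to <ℕ-wellFounded)
open import Data.Nat.ListAction using (sum)
open import Data.Nat.ListAction.Properties using (sum-++; sum-↭)
open import Data.Nat.Properties
  using ( m<m+n; ∸-monoʳ-<; m+n∸m≡n; m≤n⇒∃[o]m+o≡n; +-monoˡ-<; +-monoʳ-<; +-mono-<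
        ; ≰⇒>; ≮⇒≥; ≤-pred)
open import Data.Product using (Σ-syntax; ∃; ∃-syntax; _×_; _,_; proj₁; proj₂; map₁)
open import Data.Sum using (_⊎_; inj₁; inj₂)
open import Data.Unit using (⊤; tt)
open import Function using (flip; _∘_)
open import Induction.WellFounded using (WellFounded; Acc; acc)
open import Relation.Binary using (Decidable; IsPartialOrder)
import Relation.Binary.Construct.NonStrictToStrict as ToStrict
open import Relation.Binary.Lattice using (JoinSemilattice)
import Relation.Binary.Lattice.Properties.JoinSemilattice as JoinSemilatticeProperties
open import Relation.Binary.PropositionalEquality as ≡ using (_≡_; refl)
open import Relation.Nullary using (¬_; yes; no)
open import Relation.Nullary.Decidable using (_×-dec_; ¬?; decidable-stable; fromWitnessFalse; toWitnessFalse)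

open import Defs

module CommutativeRingProperties {c ℓ} (R : CommutativeRing c ℓ) where
  open CommutativeRing R
  open import Algebra.Properties.Ring ring using (x[y-z]≈xy-xz; [y-z]x≈yx-zx)
  open import Algebra.Properties.AbelianGroup +-abelianGroup
    using (x∙y⁻¹≈ε⇒x≈y; //-rightDividesˡ)
  open import Relation.Binary.Reasoning.Setoid setoid

  [x-z][y-z]≈0⇒[x-z]y≈[x-z]z : ∀ {x y z} → (x - z) * (y - z) ≈ 0# → (x - z) * y ≈ (x - z) * z
  [x-z][y-z]≈0⇒[x-z]y≈[x-z]z {x} {y} {z} e =
    x∙y⁻¹≈ε⇒x≈y _ _ (trans (sym (x[y-z]≈xy-xz (x - z) y z)) e)

  [x-z][y-z]≈0⇒xy≈zx+zy-zz : ∀ {x y z} → (x - z) * (y - z) ≈ 0# →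
    x * y ≈ (z * x + z * y) - z * z
  [x-z][y-z]≈0⇒xy≈zx+zy-zz {x} {y} {z} e = begin
    x * y                      ≈⟨ //-rightDividesˡ (z * y) (x * y) ⟨
    (x * y - z * y) + z * y    ≈⟨ +-congʳ ([y-z]x≈yx-zx y x z) ⟨
    (x - z) * y + z * y        ≈⟨ +-congʳ ([x-z][y-z]≈0⇒[x-z]y≈[x-z]z e) ⟩
    (x - z) * z + z * y        ≈⟨ +-congʳ ([y-z]x≈yx-zx z x z) ⟩
    (x * z - z * z) + z * y    ≈⟨ +-assoc _ _ _ ⟩
    x * z + (- (z * z) + z * y) ≈⟨ +-cong (*-comm x z) (+-comm _ _) ⟩
    z * x + (z * y - z * z)    ≈⟨ +-assoc _ _ _ ⟨
    (z * x + z * y) - z * z    ∎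

  [x-z][y-z]≈0⇒yx-yz≈0⇒zz≈xz : ∀ {x y z} → (x - z) * (y - z) ≈ 0# → y * x - y * z ≈ 0# →
    z * z ≈ x * z
  [x-z][y-z]≈0⇒yx-yz≈0⇒zz≈xz {x} {y} {z} e e′ = sym (x∙y⁻¹≈ε⇒x≈y _ _ (begin
    x * z - z * z   ≈⟨ [y-z]x≈yx-zx z x z ⟨
    (x - z) * z     ≈⟨ [x-z][y-z]≈0⇒[x-z]y≈[x-z]z e ⟨
    (x - z) * y     ≈⟨ *-comm _ _ ⟩
    y * (x - z)     ≈⟨ x[y-z]≈xy-xz y x z ⟩
    y * x - y * z   ≈⟨ e′ ⟩
    0#              ∎))

module LinearSpan {c ℓ} (R : Ring c ℓ) where
  open Ring R hiding (zero)
  open import Algebra.Properties.Ring R using (-‿distribˡ-*; -‿distribʳ-*)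

  data Span {i} {I : Set i} (g : I → Carrier) : Carrier → Set (c ⊔ ℓ ⊔ i) where
    gen  : ∀ j → Span g (g j)
    zero : Span g 0#
    add  : ∀ {x y} → Span g x → Span g y → Span g (x + y)
    neg  : ∀ {x} → Span g x → Span g (- x)
    resp : ∀ {x y} → x ≈ y → Span g x → Span g y

  module _ {i i′} {I : Set i} {I′ : Set i′} {g : I → Carrier} {g′ : I′ → Carrier} where

    Span-⊆ : (∀ j → Span g′ (g j)) → ∀ {x} → Span g x → Span g′ x
    Span-⊆ g⊆ (gen j)    = g⊆ j
    Span-⊆ g⊆ zero       = zero
    Span-⊆ g⊆ (add s t)  = add (Span-⊆ g⊆ s) (Span-⊆ g⊆ t)
    Span-⊆ g⊆ (neg s)    = neg (Span-⊆ g⊆ s)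
    Span-⊆ g⊆ (resp e s) = resp e (Span-⊆ g⊆ s)

  module _ {i} {I : Set i} {g : I → Carrier} where

    Span-*ˡ : ∀ {a} → (∀ j → Span g (a * g j)) → ∀ {x} → Span g x → Span g (a * x)
    Span-*ˡ ag∈ (gen j)    = ag∈ j
    Span-*ˡ ag∈ zero       = resp (sym (zeroʳ _)) zero
    Span-*ˡ ag∈ (add s t)  = resp (sym (distribˡ _ _ _)) (add (Span-*ˡ ag∈ s) (Span-*ˡ ag∈ t))
    Span-*ˡ ag∈ (neg s)    = resp (-‿distribʳ-* _ _) (neg (Span-*ˡ ag∈ s))
    Span-*ˡ ag∈ (resp e s) = resp (*-congˡ e) (Span-*ˡ ag∈ s)

    Span-* : (∀ j k → Span g (g j * g k)) → ∀ {x y} → Span g x → Span g y → Span g (x * y)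
    Span-* gg∈ (gen j)    t = Span-*ˡ (gg∈ j) t
    Span-* gg∈ zero       t = resp (sym (zeroˡ _)) zero
    Span-* gg∈ (add s s′) t = resp (sym (distribʳ _ _ _)) (add (Span-* gg∈ s t) (Span-* gg∈ s′ t))
    Span-* gg∈ (neg s)    t = resp (-‿distribˡ-* _ _) (neg (Span-* gg∈ s t))
    Span-* gg∈ (resp e s) t = resp (*-congʳ e) (Span-* gg∈ s t)

module FiniteLatticeProperties (L : LatticeData) where
  open LatticeData L
  open LatticeNotions L

  ≤-isPartialOrder : IsPartialOrder _≡_ _≤_
  ≤-isPartialOrder = record
    { isPreorder = record
      { isEquivalence = ≡.isEquivalence
      ; reflexive     = λ { refl → ≤-refl _ }
      ; trans         = ≤-trans
      }
    ; antisym = ≤-antisym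
    }

  joinSemilattice : JoinSemilattice _ _ _
  joinSemilattice = record
    { isJoinSemilattice = record
      { isPartialOrder = ≤-isPartialOrder
      ; supremum       = λ x y → ∨-ub₁ x y , ∨-ub₂ x y , λ z → ∨-lub
      }
    }

  open JoinSemilatticeProperties joinSemilattice public using (∨-comm)

  _≤?_ : Decidable _≤_
  _≤?_ = JoinSemilatticeProperties.≈-dec⇒≤-dec joinSemilattice _≟_

  _<?_ : Decidable _<_
  _<?_ = ToStrict.<-decidable _≡_ _≤_ _≟_ _≤?_

  _⋖?_ : Decidable _⋖_
  x ⋖? y = (x <? y) ×-dec all? (λ z → ¬? ((x <? z) ×-dec (z <? y)))

  data Comparison (x y : Fin n) : Set where
    equal        : x ≡ y → Comparison x y
    less         : x < y → Comparison x y
    greater      : y < x → Comparison x y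
    incomparable : ¬ x ≤ y → ¬ y ≤ x → Comparison x y

  compare : ∀ x y → Comparison x y
  compare x y with x ≟ y | x ≤? y | y ≤? x
  ... | yes x≡y | _       | _       = equal x≡y
  ... | no x≢y  | yes x≤y | _       = less (x≤y , x≢y)
  ... | no x≢y  | no _    | yes y≤x = greater (y≤x , λ y≡x → x≢y (≡.sym y≡x))
  ... | no _    | no x≰y  | no y≰x  = incomparable x≰y y≰x

  <⇒≱ : ∀ {x y} → x < y → ¬ y ≤ x
  <⇒≱ = ToStrict.<⇒≱ _≡_ _≤_ ≤-antisym

  <-wellFounded : WellFounded _<_
  <-wellFounded = po-wellFounded ≤-isPartialOrder

  >-wellFounded : WellFounded (flip _<_)
  >-wellFounded = po-noetherian ≤-isPartialOrder

  ∃-cover-≤ : ∀ {x z} → x < z → ∃[ c ] x ⋖ c × c ≤ z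
  ∃-cover-≤ {x} {z} = go (<-wellFounded z)
    where
    go : ∀ {z} → Acc _<_ z → x < z → ∃[ c ] x ⋖ c × c ≤ z
    go {z} (acc rec) x<z with any? (λ y → (x <? y) ×-dec (y <? z))
    ... | yes (y , x<y , y<z) =
      let c , x⋖c , c≤y = go (rec y<z) x<y in c , x⋖c , ≤-trans c≤y (proj₁ y<z)
    ... | no ∄y = z , (x<z , λ y x<y<z → ∄y (y , x<y<z)) , ≤-refl z

  maxChain : ∀ {x y} → x ≤ y → ∃ (MaxChain x y)
  maxChain {x} {y} = go (>-wellFounded x)
    where
    go : ∀ {x} → Acc (flip _<_) x → x ≤ y → ∃ (MaxChain x y)
    go {x} (acc rec) x≤y with x ≟ y
    ... | yes refl = 0 , done x
    ... | no x≢y =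
      let c , x⋖c , c≤y = ∃-cover-≤ (x≤y , x≢y)
          k , c⇝y       = go (rec (proj₁ x⋖c)) c≤y
      in suc k , step x⋖c c⇝y

  _◅◅_ : ∀ {x y z k l} → MaxChain x y k → MaxChain y z l → MaxChain x z (k +ℕ l)
  done _       ◅◅ y⇝z = y⇝z
  step x⋖c c⇝y ◅◅ y⇝z = step x⋖c (c⇝y ◅◅ y⇝z)

  cover-join : ∀ {x y b} → x ⋖ y → b ≤ y → ¬ b ≤ x → b ∨ x ≡ y
  cover-join {x} {y} {b} (x<y , nothing-between) b≤y b≰x with (b ∨ x) ≟ y
  ... | yes b∨x≡y = b∨x≡y
  ... | no b∨x≢y =
    ⊥-elim (nothing-between (b ∨ x) (x<b∨x , (∨-lub b≤y (proj₁ x<y) , b∨x≢y)))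
    where
    x<b∨x : x < (b ∨ x)
    x<b∨x = ∨-ub₂ b x , λ x≡b∨x → b≰x (≡.subst (b ≤_) (≡.sym x≡b∨x) (∨-ub₁ b x))

module MatroidProperties (M : Matroid) where
  open Matroid M
  open FiniteLatticeProperties lat public

  ∃-atom-≤-≰ : ∀ {x y} → x < y → ∃[ b ] IsAtom b × b ≤ y × ¬ b ≤ x
  ∃-atom-≤-≰ {x} {y} x<y with any? (λ b → (bot ⋖? b) ×-dec (b ≤? y) ×-dec ¬? (b ≤? x))
  ... | yes found = found
  ... | no ∄b = ⊥-elim (<⇒≱ x<y (atomic y x atoms≤x))
    where
    atoms≤x : ∀ a → IsAtom a → a ≤ y → a ≤ x
    atoms≤x a a-atom a≤y = decidable-stable (a ≤? x) (λ a≰x → ∄b (a , a-atom , a≤y , a≰x))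

  rk-∅ : rk bot ≡ 0
  rk-∅ = ≡.sym (ranked bot 0 (done bot))

  rk-chain : ∀ {x y k} → MaxChain x y k → rk y ≡ rk x +ℕ k
  rk-chain {x} {y} {k} x⇝y =
    let j , ∅⇝x = maxChain (bot-≤ x)
    in ≡.trans (≡.sym (ranked y (j +ℕ k) (∅⇝x ◅◅ x⇝y))) (≡.cong (_+ℕ k) (ranked x j ∅⇝x))

  rk-gap : ∀ {x y k} → MaxChain x y k → rk y ∸ℕ rk x ≡ k
  rk-gap {x} {k = k} x⇝y = ≡.trans (≡.cong (_∸ℕ rk x) (rk-chain x⇝y)) (m+n∸m≡n (rk x) k)

  rk-strictMono : ∀ {x y} → x < y → rk x <ℕ rk y
  rk-strictMono {x} x<y with maxChain (proj₁ x<y)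
  ... | zero  , done _ = ⊥-elim (proj₂ x<y refl)
  ... | suc k , x⇝y    = ≡.subst (rk x <ℕ_) (≡.sym (rk-chain x⇝y)) (m<m+n (rk x) z<s)

  maxRank : ℕ
  maxRank = max 0 (map rk (allFin n))

  rk≤maxRank : ∀ x → rk x ≤ℕ maxRank
  rk≤maxRank x = All.lookup (xs≤max 0 (map rk (allFin n))) (∈-map⁺ rk (∈-allFin x))

  corank : Fin n → ℕ
  corank x = maxRank ∸ℕ rk x

  corank-strictAnti : ∀ {x y} → x < y → corank y <ℕ corank x
  corank-strictAnti {y = y} x<y = ∸-monoʳ-< (rk-strictMono x<y) (rk≤maxRank y)

module AugmentedChowRingProperties (M : Matroid) where
  open Matroid M
  open MatroidProperties M
  open Chow M

  augmentedChowRing : CommutativeRing 0ℓ 0ℓ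
  augmentedChowRing = record
    { Carrier = Poly ; _≈_ = _≈_ ; _+_ = _+p_ ; _*_ = _*p_ ; -_ = -p_ ; 0# = 0p ; 1# = 1p
    ; isCommutativeRing = record
      { isRing = record
        { +-isAbelianGroup = record
          { isGroup = record
            { isMonoid = record
              { isSemigroup = record
                { isMagma = record
                  { isEquivalence = record { refl = ≈-refl ; sym = ≈-sym ; trans = ≈-trans }
                  ; ∙-cong = +-cong }
                ; assoc = +-assoc }
              ; identity = +-idˡ , λ x → ≈-trans (+-comm x 0p) (+-idˡ x) }
            ; inverse = -‿invˡ , λ x → ≈-trans (+-comm x (-p x)) (-‿invˡ x)
            ; ⁻¹-cong = neg-cong }
          ; comm = +-comm }
        ; *-cong = *-cong
        ; *-assoc = *-assoc
        ; *-identity = *-idˡ , λ x → ≈-trans (*-comm x 1p) (*-idˡ x)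
        ; distrib = distribˡ , λ x y z → ≈-trans (*-comm (y +p z) x)
                                  (≈-trans (distribˡ x y z) (+-cong (*-comm x y) (*-comm x z))) }
      ; *-comm = *-comm } }

  module A = CommutativeRing augmentedChowRing
  open CommutativeRingProperties augmentedChowRing
  open import Algebra.Properties.CommutativeSemigroup A.*-commutativeSemigroup using (x∙yz≈y∙xz)
  open import Relation.Binary.Reasoning.Setoid A.setoid

  >⇒NonEmpty : ∀ {x y} → x < y → NonEmpty y
  >⇒NonEmpty {x} (x≤y , x≢y) = fromWitnessFalse λ y≡∅ →
    x≢y (≡.trans (≤-antisym (≡.subst (x ≤_) y≡∅ x≤y) (bot-≤ x)) (≡.sym y≡∅))

  ∅<flat : ∀ (F : Flat̄) → bot < proj₁ F
  ∅<flat F = bot-≤ (proj₁ F) , λ ∅≡F → toWitnessFalse (proj₂ F) (≡.sym ∅≡F)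

  Flat̄-≡ : ∀ {F G : Flat̄} → proj₁ F ≡ proj₁ G → F ≡ G
  Flat̄-≡ {x , p} {.x , q} refl = ≡.cong (x ,_) (T-irrelevant p q)

  -- The convention h_∅ = 0, under which h_a² = 0 for an atom a is the case x = ∅ of cover-square.
  h̃ : Fin n → Poly
  h̃ x with x ≟ bot
  ... | yes _   = 0p
  ... | no x≢∅ = h (x , fromWitnessFalse x≢∅)

  h̃-∅ : h̃ bot ≡ 0p
  h̃-∅ with bot ≟ bot
  ... | yes _   = refl
  ... | no ∅≢∅ = ⊥-elim (∅≢∅ refl)

  h̃-flat : ∀ F → h̃ (proj₁ F) ≡ h F
  h̃-flat F with proj₁ F ≟ bot
  ... | yes F≡∅ = ⊥-elim (toWitnessFalse (proj₂ F) F≡∅)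
  ... | no _    = ≡.cong h (Flat̄-≡ refl)

  join-relation : ∀ F G J → proj₁ G ∨ proj₁ F ≡ proj₁ J → (h F -p h J) *p (h G -p h J) ≈ 0p
  join-relation F G (_ , J≢∅) refl = rel-join F G J≢∅

  atom-relation : ∀ a F J → IsAtom (proj₁ a) → proj₁ F ∨ proj₁ a ≡ proj₁ J →
    (h a *p h F) -p (h a *p h J) ≈ 0p
  atom-relation a F (_ , J≢∅) a-atom refl = rel-atom a F a-atom J≢∅

  -- For x ≠ ∅ take an atom b ≤ F, b ≰ x, so that b ∨ x = F; then combine the join
  -- relation of x and b with the atom relation h_b h_x = h_b h_F.
  cover-square : ∀ {x} F → x ⋖ proj₁ F → h F *p h F ≈ h̃ x *p h F
  cover-square {x} F x⋖F with x ≟ bot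
  ... | yes refl = ≈-trans (rel-atom² F x⋖F) (≈-sym (A.zeroˡ (h F)))
  ... | no x≢∅ with ∃-atom-≤-≰ (proj₁ x⋖F)
  ...   | b , b-atom , b≤F , b≰x = [x-z][y-z]≈0⇒yx-yz≈0⇒zz≈xz
    (join-relation X B F b∨x≡F) (atom-relation B X F b-atom (≡.trans (∨-comm x b) b∨x≡F))
    where
    X = x , fromWitnessFalse x≢∅
    B = b , >⇒NonEmpty (proj₁ b-atom)
    b∨x≡F = cover-join x⋖F b≤F b≰x

  ^p-+ : ∀ x a b → x ^p (a +ℕ b) ≈ x ^p a *p x ^p b
  ^p-+ x zero    b = ≈-sym (*-idˡ _)
  ^p-+ x (suc a) b = ≈-trans (*-cong ≈-refl (^p-+ x a b)) (≈-sym (*-assoc _ _ _))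

  chain-absorb : ∀ {x k} F → MaxChain x (proj₁ F) k → h̃ x *p h F ^p k ≈ h F ^p suc k
  chain-absorb F (done _) = *-cong (A.reflexive (h̃-flat F)) ≈-refl
  chain-absorb {x} {suc k} F (step {y = y} x⋖y y⇝F) = begin
    h̃ x *p hF ^p suc k         ≈⟨ *-cong ≈-refl IH ⟨
    h̃ x *p (h Y *p hF ^p k)    ≈⟨ *-assoc _ _ _ ⟨
    (h̃ x *p h Y) *p hF ^p k    ≈⟨ *-cong (cover-square Y x⋖y) ≈-refl ⟨
    (h Y *p h Y) *p hF ^p k    ≈⟨ *-assoc _ _ _ ⟩
    h Y *p (h Y *p hF ^p k)    ≈⟨ *-cong ≈-refl IH ⟩
    h Y *p (hF *p hF ^p k)     ≈⟨ x∙yz≈y∙xz _ _ _ ⟩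
    hF *p (h Y *p hF ^p k)     ≈⟨ *-cong ≈-refl IH ⟩
    hF *p hF ^p suc k          ∎
    where
    hF = h F
    Y = y , >⇒NonEmpty (proj₁ x⋖y)
    IH : h Y *p hF ^p k ≈ hF ^p suc k
    IH = ≡.subst (λ t → t *p hF ^p k ≈ hF ^p suc k) (h̃-flat Y) (chain-absorb F y⇝F)

  absorb : ∀ {x} F a → x ≤ proj₁ F → rk (proj₁ F) ∸ℕ rk x ≤ℕ a →
    h̃ x *p h F ^p a ≈ h F ^p suc a
  absorb {x} F a x≤F gap≤a with maxChain x≤F
  ... | k , x⇝F with m≤n⇒∃[o]m+o≡n (≡.subst (_≤ℕ a) (rk-gap x⇝F) gap≤a)
  ...   | d , refl = begin
    h̃ x *p hF ^p (k +ℕ d)          ≈⟨ *-cong ≈-refl (^p-+ hF k d) ⟩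
    h̃ x *p (hF ^p k *p hF ^p d)    ≈⟨ *-assoc _ _ _ ⟨
    (h̃ x *p hF ^p k) *p hF ^p d    ≈⟨ *-cong (chain-absorb F x⇝F) ≈-refl ⟩
    hF ^p suc k *p hF ^p d          ≈⟨ ^p-+ hF (suc k) d ⟨
    hF ^p suc (k +ℕ d)              ∎
    where hF = h F

  h^>rk≈0 : ∀ F a → rk (proj₁ F) ≤ℕ a → h F ^p suc a ≈ 0p
  h^>rk≈0 F a rk≤a = begin
    h F ^p suc a         ≈⟨ absorb F a (bot-≤ (proj₁ F)) gap≤a ⟨
    h̃ bot *p h F ^p a    ≡⟨ ≡.cong (_*p h F ^p a) h̃-∅ ⟩
    0p *p h F ^p a       ≈⟨ A.zeroˡ _ ⟩
    0p                   ∎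
    where
    gap≤a : rk (proj₁ F) ∸ℕ rk bot ≤ℕ a
    gap≤a = ≡.subst (λ r → rk (proj₁ F) ∸ℕ r ≤ℕ a) (≡.sym rk-∅) rk≤a

  hFhG≈hJhF+hJhG-hJhJ : ∀ F G J → proj₁ G ∨ proj₁ F ≡ proj₁ J →
    h F *p h G ≈ (h J *p h F +p h J *p h G) -p (h J *p h J)
  hFhG≈hJhF+hJhG-hJhJ F G J G∨F≡J = [x-z][y-z]≈0⇒xy≈zx+zy-zz (join-relation F G J G∨F≡J)

module Straightening (M : Matroid) where
  open Matroid M
  open MatroidProperties M
  open Chow M
  open AugmentedChowRingProperties M
  open LinearSpan A.ring
  open PermutationSetoidProperties A.setoid using (foldr-commMonoid)
  open import Algebra.Properties.CommutativeSemigroup A.*-commutativeSemigroup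
    using (x∙yz≈y∙xz; xy∙z≈y∙xz)
  open import Algebra.Properties.Ring A.ring using ([y-z]x≈yx-zx; -‿distribˡ-*)
  open import Algebra.Properties.AbelianGroup A.+-abelianGroup
    using (ε⁻¹≈ε; ⁻¹-involutive; ⁻¹-∙-comm)
  open import Relation.Binary.Reasoning.Setoid A.setoid

  Word : Set
  Word = List Flat̄

  prod : Word → Poly
  prod w = foldr _*p_ 1p (map h w)

  weight : Word → ℕ
  weight w = sum (map (corank ∘ proj₁) w)

  toWord : MonoData → Word
  toWord []            = []
  toWord ((F , a) ∷ r) = replicate a F ++ toWord r

  prod-↭ : ∀ {w v} → w ↭ v → prod w ≈ prod v
  prod-↭ w↭v =
    foldr-commMonoid A.*-isCommutativeMonoid (↭⇒↭ₛ′ A.isEquivalence (↭.map⁺ h w↭v))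

  weight-↭ : ∀ {w v} → w ↭ v → weight w ≡ weight v
  weight-↭ w↭v = sum-↭ (↭.map⁺ (corank ∘ proj₁) w↭v)

  prod-++ : ∀ w v → prod (w ++ v) ≈ prod w *p prod v
  prod-++ []      v = ≈-sym (*-idˡ _)
  prod-++ (F ∷ w) v = ≈-trans (*-cong ≈-refl (prod-++ w v)) (≈-sym (*-assoc _ _ _))

  weight-++ : ∀ w v → weight (w ++ v) ≡ weight w +ℕ weight v
  weight-++ w v =
    ≡.trans (≡.cong sum (map-++ (corank ∘ proj₁) w v)) (sum-++ (map (corank ∘ proj₁) w) _)

  prod-replicate : ∀ a F → prod (replicate a F) ≈ h F ^p a
  prod-replicate zero    F = ≈-refl
  prod-replicate (suc a) F = *-cong ≈-refl (prod-replicate a F)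

  monomial≈prod-toWord : ∀ md → monomial md ≈ prod (toWord md)
  monomial≈prod-toWord []            = ≈-refl
  monomial≈prod-toWord ((F , a) ∷ r) = begin
    h F ^p a *p monomial r
      ≈⟨ *-cong (≈-sym (prod-replicate a F)) (monomial≈prod-toWord r) ⟩
    prod (replicate a F) *p prod (toWord r)
      ≈⟨ prod-++ (replicate a F) (toWord r) ⟨
    prod (replicate a F ++ toWord r)
      ∎

  IsChainAbove : Fin n → MonoData → Set
  IsChainAbove x []            = ⊤
  IsChainAbove x ((F , a) ∷ r) = x < proj₁ F × 1 ≤ℕ a × IsChainAbove (proj₁ F) r

  ChainRearrangement : Fin n → Word → Set
  ChainRearrangement x w = Σ[ md ∈ MonoData ] IsChainAbove x md × toWord md ↭ w

  Incomparable : Flat̄ → Flat̄ → Set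
  Incomparable F G = ¬ proj₁ F ≤ proj₁ G × ¬ proj₁ G ≤ proj₁ F

  IncomparablePair : Word → Set
  IncomparablePair w =
    Σ[ F ∈ Flat̄ ] Σ[ G ∈ Flat̄ ] Σ[ v ∈ Word ] Incomparable F G × w ↭ F ∷ G ∷ v

  IncomparablePair-resp-↭ : ∀ {w w′} → w ↭ w′ → IncomparablePair w → IncomparablePair w′
  IncomparablePair-resp-↭ w↭w′ (F , G , v , F∥G , w↭) =
    F , G , v , F∥G , ↭-trans (↭-sym w↭w′) w↭

  IncomparablePair-++ : ∀ u {w} → IncomparablePair w → IncomparablePair (u ++ w)
  IncomparablePair-++ u (F , G , v , F∥G , w↭) =
    F , G , u ++ v , F∥G , ↭-trans (++⁺ˡ u w↭) (shifts u (F ∷ G ∷ []))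

  insert : ∀ {x} F md → x < proj₁ F → IsChainAbove x md →
    ChainRearrangement x (F ∷ toWord md) ⊎ IncomparablePair (F ∷ toWord md)
  insert F [] x<F _ = inj₁ ((F , 1) ∷ [] , (x<F , s≤s z≤n , tt) , ↭-refl)
  insert F ((G , zero) ∷ r) _ (_ , () , _)
  insert F ((G , suc a) ∷ r) x<F (x<G , _ , chain) with compare (proj₁ F) (proj₁ G)
  ... | equal F≡G =
    inj₁ ( (G , suc (suc a)) ∷ r , (x<G , s≤s z≤n , chain)
         , ↭-reflexive (≡.cong (_∷ _) (Flat̄-≡ (≡.sym F≡G))))
  ... | less F<G =
    inj₁ ((F , 1) ∷ (G , suc a) ∷ r , (x<F , s≤s z≤n , F<G , s≤s z≤n , chain) , ↭-refl)
  ... | incomparable F≰G G≰F = inj₂ (F , G , replicate a G ++ toWord r , (F≰G , G≰F) , ↭-refl)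
  ... | greater G<F with insert F r G<F chain
  ...   | inj₁ (md , chain′ , md↭) =
    inj₁ ( (G , suc a) ∷ md , (x<G , s≤s z≤n , chain′)
         , ↭-trans (++⁺ˡ Gᵃ md↭) (shift F Gᵃ (toWord r)))
    where Gᵃ = replicate (suc a) G
  ...   | inj₂ pair =
    inj₂ (IncomparablePair-resp-↭ (shift F Gᵃ (toWord r)) (IncomparablePair-++ Gᵃ pair))
    where Gᵃ = replicate (suc a) G

  sort : ∀ w → ChainRearrangement bot w ⊎ IncomparablePair w
  sort [] = inj₁ ([] , tt , ↭-refl)
  sort (F ∷ w) with sort w
  ... | inj₂ pair = inj₂ (IncomparablePair-++ (F ∷ []) pair)
  ... | inj₁ (md , chain , md↭w) with insert F md (∅<flat F) chain
  ...   | inj₁ (md′ , chain′ , md′↭) = inj₁ (md′ , chain′ , ↭-trans md′↭ (prep F md↭w))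
  ...   | inj₂ pair = inj₂ (IncomparablePair-resp-↭ (prep F md↭w) pair)

  Reducible : MonoData → Set
  Reducible md = Σ[ v ∈ Word ] monomial md ≈ prod v × weight v <ℕ weight (toWord md)

  Reducible-∷ : ∀ G a {md} → Reducible md → Reducible ((G , a) ∷ md)
  Reducible-∷ G a {md} (v , md≈v , v<md) = Gᵃ ++ v , eq , lt
    where
    Gᵃ = replicate a G
    eq : h G ^p a *p monomial md ≈ prod (Gᵃ ++ v)
    eq = begin
      h G ^p a *p monomial md  ≈⟨ *-cong (≈-sym (prod-replicate a G)) md≈v ⟩
      prod Gᵃ *p prod v        ≈⟨ prod-++ Gᵃ v ⟨
      prod (Gᵃ ++ v)           ∎
    lt : weight (Gᵃ ++ v) <ℕ weight (Gᵃ ++ toWord md)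
    lt = ≡.subst₂ _<ℕ_ (≡.sym (weight-++ Gᵃ v)) (≡.sym (weight-++ Gᵃ (toWord md)))
           (+-monoʳ-< (weight Gᵃ) v<md)

  absorb-reducible : ∀ {G F} b a r → proj₁ G < proj₁ F → rk (proj₁ F) ∸ℕ rk (proj₁ G) ≤ℕ a →
    Reducible ((G , suc b) ∷ (F , a) ∷ r)
  absorb-reducible {G} {F} b a r G<F gap≤a =
    F ∷ rest , eq , +-monoˡ-< (weight rest) (corank-strictAnti G<F)
    where
    rest = toWord ((G , b) ∷ (F , a) ∷ r)
    absorbed : h G *p h F ^p a ≈ h F ^p suc a
    absorbed =
      ≡.subst (λ t → t *p h F ^p a ≈ h F ^p suc a) (h̃-flat G) (absorb F a (proj₁ G<F) gap≤a)
    eq : (h G *p h G ^p b) *p (h F ^p a *p monomial r) ≈ h F *p prod rest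
    eq = begin
      (h G *p h G ^p b) *p (h F ^p a *p monomial r)  ≈⟨ xy∙z≈y∙xz _ _ _ ⟩
      h G ^p b *p (h G *p (h F ^p a *p monomial r))  ≈⟨ *-cong ≈-refl (*-assoc _ _ _) ⟨
      h G ^p b *p ((h G *p h F ^p a) *p monomial r)  ≈⟨ *-cong ≈-refl (*-cong absorbed ≈-refl) ⟩
      h G ^p b *p (h F ^p suc a *p monomial r)       ≈⟨ *-cong ≈-refl (*-assoc _ _ _) ⟩
      h G ^p b *p (h F *p (h F ^p a *p monomial r))  ≈⟨ x∙yz≈y∙xz _ _ _ ⟩
      h F *p (h G ^p b *p (h F ^p a *p monomial r))  ≈⟨ *-cong ≈-refl (monomial≈prod-toWord (_ ∷ _ ∷ r)) ⟩
      h F *p prod rest                                ∎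

  data Classification (md : MonoData) : Set where
    admissible : Admissible md → Classification md
    vanishing  : monomial md ≈ 0p → Classification md
    reducible  : Reducible md → Classification md

  classifyTail : ∀ G b md → IsChainAbove (proj₁ G) md →
    AdmissibleTail (proj₁ G) md ⊎ Reducible ((G , suc b) ∷ md)
  classifyTail G b [] _ = inj₁ tt
  classifyTail G b ((F , zero) ∷ r) (_ , () , _)
  classifyTail G b ((F , suc a) ∷ r) (G<F , _ , chain)
    with suc a <ℕ? rk (proj₁ F) ∸ℕ rk (proj₁ G)
  ... | no a≮gap = inj₂ (absorb-reducible b (suc a) r G<F (≮⇒≥ a≮gap))
  ... | yes a<gap with classifyTail F a r chain
  ...   | inj₁ tail = inj₁ (G<F , s≤s z≤n , a<gap , tail)
  ...   | inj₂ red  = inj₂ (Reducible-∷ G (suc b) red)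

  classify : ∀ md → IsChainAbove bot md → Classification md
  classify [] _ = admissible tt
  classify ((F , zero) ∷ r) (_ , () , _)
  classify ((F , suc a) ∷ r) (∅<F , _ , chain) with suc a ≤ℕ? rk (proj₁ F)
  ... | no a≰rk =
    vanishing (≈-trans (*-cong (h^>rk≈0 F a (≤-pred (≰⇒> a≰rk))) ≈-refl) (A.zeroˡ _))
  ... | yes a≤rk with classifyTail F a r chain
  ...   | inj₁ tail = admissible (∅<F , s≤s z≤n , a≤rk , tail)
  ...   | inj₂ red  = reducible red

  admissibleMonomial : AdmMono → Poly
  admissibleMonomial = monomial ∘ proj₁

  Spanned : Poly → Set
  Spanned = Span admissibleMonomial

  chain-monomial-spanned : ∀ md → IsChainAbove bot md →
    (∀ u → weight u <ℕ weight (toWord md) → Spanned (prod u)) → Spanned (monomial md)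
  chain-monomial-spanned md chain lighter-spanned with classify md chain
  ... | admissible adm              = gen (md , adm)
  ... | vanishing md≈0              = resp (≈-sym md≈0) zero
  ... | reducible (v , md≈v , v<md) = resp (≈-sym md≈v) (lighter-spanned v v<md)

  incomparable-spanned : ∀ {F G} v → Incomparable F G →
    (∀ u → weight u <ℕ weight (F ∷ G ∷ v) → Spanned (prod u)) → Spanned (prod (F ∷ G ∷ v))
  incomparable-spanned {F} {G} v (F≰G , G≰F) lighter-spanned =
    resp (≈-sym eq) (add (add (lighter-spanned (J ∷ F ∷ v) lt₁) (lighter-spanned (J ∷ G ∷ v) lt₂))
                         (neg (lighter-spanned (J ∷ J ∷ v) lt₃)))
    where
    F<J : proj₁ F < (proj₁ G ∨ proj₁ F)
    F<J = ∨-ub₂ _ _ , λ F≡J → G≰F (≡.subst (proj₁ G ≤_) (≡.sym F≡J) (∨-ub₁ _ _))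
    G<J : proj₁ G < (proj₁ G ∨ proj₁ F)
    G<J = ∨-ub₁ _ _ , λ G≡J → F≰G (≡.subst (proj₁ F ≤_) (≡.sym G≡J) (∨-ub₂ _ _))
    J : Flat̄
    J = proj₁ G ∨ proj₁ F , >⇒NonEmpty F<J
    P = prod v
    eq : prod (F ∷ G ∷ v) ≈ (prod (J ∷ F ∷ v) +p prod (J ∷ G ∷ v)) -p prod (J ∷ J ∷ v)
    eq = begin
      h F *p (h G *p P)
        ≈⟨ *-assoc _ _ _ ⟨
      (h F *p h G) *p P
        ≈⟨ *-cong (hFhG≈hJhF+hJhG-hJhJ F G J refl) ≈-refl ⟩
      ((h J *p h F +p h J *p h G) -p (h J *p h J)) *p P
        ≈⟨ [y-z]x≈yx-zx P _ _ ⟩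
      ((h J *p h F +p h J *p h G) *p P) -p ((h J *p h J) *p P)
        ≈⟨ +-cong (A.distribʳ P _ _) (neg-cong (*-assoc _ _ _)) ⟩
      ((h J *p h F) *p P +p (h J *p h G) *p P) -p (h J *p (h J *p P))
        ≈⟨ +-cong (+-cong (*-assoc _ _ _) (*-assoc _ _ _)) ≈-refl ⟩
      (h J *p (h F *p P) +p h J *p (h G *p P)) -p (h J *p (h J *p P))
        ∎
    cJ<cF = corank-strictAnti F<J
    cJ<cG = corank-strictAnti G<J
    lt₁ : weight (J ∷ F ∷ v) <ℕ weight (F ∷ G ∷ v)
    lt₁ = ≡.subst (_<ℕ weight (F ∷ G ∷ v)) (weight-↭ {F ∷ J ∷ v} (swap F J ↭-refl))
            (+-monoʳ-< (corank (proj₁ F)) (+-monoˡ-< (weight v) cJ<cG))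
    lt₂ : weight (J ∷ G ∷ v) <ℕ weight (F ∷ G ∷ v)
    lt₂ = +-monoˡ-< (weight (G ∷ v)) cJ<cF
    lt₃ : weight (J ∷ J ∷ v) <ℕ weight (F ∷ G ∷ v)
    lt₃ = +-mono-< cJ<cF (+-monoˡ-< (weight v) cJ<cG)

  prod-spanned : ∀ w → Spanned (prod w)
  prod-spanned w = go {w} (<ℕ-wellFounded (weight w))
    where
    go : ∀ {w} → Acc _<ℕ_ (weight w) → Spanned (prod w)
    go {w} (acc rec) = spanned-by (sort w)
      where
      lighter : ∀ {w′} → w′ ↭ w → ∀ u → weight u <ℕ weight w′ → Spanned (prod u)
      lighter w′↭w u u<w′ = go {u} (rec (≡.subst (weight u <ℕ_) (weight-↭ w′↭w) u<w′))

      spanned-by : ChainRearrangement bot w ⊎ IncomparablePair w → Spanned (prod w)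
      spanned-by (inj₁ (md , chain , md↭w)) =
        resp (≈-trans (monomial≈prod-toWord md) (prod-↭ md↭w))
             (chain-monomial-spanned md chain (lighter md↭w))
      spanned-by (inj₂ (F , G , v , F∥G , w↭)) =
        resp (≈-sym (prod-↭ w↭)) (incomparable-spanned v F∥G (lighter (↭-sym w↭)))

  words-span : ∀ x → Span prod x
  words-span (h F)    = resp (A.*-identityʳ (h F)) (gen (F ∷ []))
  words-span 0p       = zero
  words-span 1p       = gen []
  words-span (x +p y) = add (words-span x) (words-span y)
  words-span (x *p y) =
    Span-* (λ w v → resp (prod-++ w v) (gen (w ++ v))) (words-span x) (words-span y)
  words-span (-p x)   = neg (words-span x)

  spanned : ∀ x → Spanned x
  spanned x = Span-⊆ prod-spanned (words-span x)

  fromℤ-neg : ∀ c → fromℤ (-ℤ c) ≈ -p fromℤ c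
  fromℤ-neg (+ zero)  = ≈-sym ε⁻¹≈ε
  fromℤ-neg (+ suc k) = ≈-refl
  fromℤ-neg -[1+ k ]  = ≈-sym (⁻¹-involutive _)

  negate : List (ℤ × AdmMono) → List (ℤ × AdmMono)
  negate = map (map₁ -ℤ_)

  linComb-negate : ∀ cs → linComb (negate cs) ≈ -p linComb cs
  linComb-negate []             = ≈-sym ε⁻¹≈ε
  linComb-negate ((c , m) ∷ cs) = ≈-trans
    (+-cong (≈-trans (*-cong (fromℤ-neg c) ≈-refl) (≈-sym (-‿distribˡ-* _ _))) (linComb-negate cs))
    (⁻¹-∙-comm _ _)

  linComb-++ : ∀ cs ds → linComb (cs ++ ds) ≈ linComb cs +p linComb ds
  linComb-++ []             ds = ≈-sym (+-idˡ _)
  linComb-++ ((c , m) ∷ cs) ds = ≈-trans (+-cong ≈-refl (linComb-++ cs ds)) (≈-sym (+-assoc _ _ _))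

  toLinComb : ∀ {x} → Spanned x → Σ[ cs ∈ List (ℤ × AdmMono) ] x ≈ linComb cs
  toLinComb (gen m) = (+ 1 , m) ∷ [] , ≈-sym
    (≈-trans (A.+-identityʳ _) (≈-trans (*-cong (A.+-identityʳ 1p) ≈-refl) (*-idˡ _)))
  toLinComb zero = [] , ≈-refl
  toLinComb (add s t) =
    let cs , x≈cs = toLinComb s
        ds , y≈ds = toLinComb t
    in cs ++ ds , ≈-trans (+-cong x≈cs y≈ds) (≈-sym (linComb-++ cs ds))
  toLinComb (neg s) =
    let cs , x≈cs = toLinComb s in negate cs , ≈-trans (neg-cong x≈cs) (≈-sym (linComb-negate cs))
  toLinComb (resp x≈y s) =
    let cs , x≈cs = toLinComb s in cs , ≈-trans (≈-sym x≈y) x≈cs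

proposition2p1 : (M : Matroid) → Chow.AdmissibleMonomialsSpan M
proposition2p1 M x = toLinComb (spanned x)
  where open Straightening M
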